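{- Let $\mathcal{C}$ be any finite collection of graphs such that every member of $\mathcal{C}$ contains a cycle (i.e. has finite girth). Then $Forb(\mathcal{C})$ is not $(\delta,\chi)$-bounded. In particular, for every integer $m\geq 2$ the family $Forb(K_3, K_{2,m})$ is not $(\delta,\chi)$-bounded, and for every integer $\ell\geq 2$ the family $Forb(K_{\ell,\ell})$ is not $(\delta,\chi)$-bounded.
   Context: All graphs are finite, simple and undirected. For a set $\mathcal{C}$ of graphs, $Forb(\mathcal{C})$ denotes the class of all graphs containing no member of $\mathcal{C}$ as an induced subgraph. $\delta(G)$ is the minimum degree and $\chi(G)$ the chromatic number of $G$. A family $\mathcal{F}$ of graphs is called $(\delta,\chi)$-bounded if there is a function $f$ with $f(x)\to\infty$ as $x\to\infty$ such that $\chi(G)\geq f(\delta(G))$ for every $G\in\mathcal{F}$. $K_n$ is the complete graph on $n$ vertices, $K_{a,b}$ the complete bipartite graph with parts of sizes $a$ and $b$. -}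

module Defs where

open import Data.Nat using (ℕ; zero; suc; _+_; _≤_; _<_; _⊓_)
open import Data.Fin using (Fin; zero; suc; toℕ; inject₁; fromℕ)
open import Data.Bool using (Bool; true; false; if_then_else_; _xor_)
open import Data.List using (List; allFin; map; foldr)
open import Data.Nat.ListAction using (sum)
open import Data.List.Membership.Propositional using (_∈_)
open import Data.Product using (Σ; _×_; ∃)
open import Function.Definitions using (Injective)
open import Relation.Binary.PropositionalEquality using (_≡_)
open import Relation.Nullary using (¬_; does)
open import Data.Fin using (_≟_)
open import Data.Nat using (_<?_)

record Graph : Set where
  field
    n     : ℕ
    Adj   : Fin n → Fin n → Bool
    adj-sym : ∀ i j → Adj i j ≡ Adj j i
    adj-irrefl : ∀ i → Adj i i ≡ false
open Graph public

_⊑ind_ : Graph → Graph → Set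
H ⊑ind G = Σ (Fin (n H) → Fin (n G)) λ f →
  Injective _≡_ _≡_ f × (∀ i j → Adj H i j ≡ Adj G (f i) (f j))

HasCycle : Graph → Set
HasCycle G = Σ ℕ λ m → Σ (Fin (3 + m) → Fin (n G)) λ c →
  Injective _≡_ _≡_ c
  × (∀ (i : Fin (2 + m)) → Adj G (c (inject₁ i)) (c (suc i)) ≡ true)
  × (Adj G (c (fromℕ (2 + m))) (c zero) ≡ true)

Forb : List Graph → Graph → Set
Forb 𝒞 G = ∀ H → H ∈ 𝒞 → ¬ (H ⊑ind G)

degree : (G : Graph) → Fin (n G) → ℕ
degree G v = sum (map (λ j → if Adj G v j then 1 else 0) (allFin (n G)))

minOver : (k : ℕ) → (Fin k → ℕ) → ℕ
minOver zero    g = 0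
minOver (suc k) g = foldr _⊓_ (g zero) (map g (allFin (suc k)))

-- minimum degree δ(G) (convention δ = 0 for the empty graph)
δ : Graph → ℕ
δ G = minOver (n G) (degree G)

Colorable : Graph → ℕ → Set
Colorable G k = Σ (Fin (n G) → Fin k) λ col →
  ∀ i j → Adj G i j ≡ true → ¬ (col i ≡ col j)

IsChromaticNumber : Graph → ℕ → Set
IsChromaticNumber G c = Colorable G c × (∀ k → k < c → ¬ Colorable G k)

TendsToInfinity : (ℕ → ℕ) → Set
TendsToInfinity f = ∀ M → Σ ℕ λ N → ∀ x → N ≤ x → M ≤ f x

DeltaChiBounded : (Graph → Set) → Set
DeltaChiBounded 𝓕 = Σ (ℕ → ℕ) λ f → TendsToInfinity f ×
  (∀ G → 𝓕 G → ∀ c → IsChromaticNumber G c → f (δ G) ≤ c)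

K : ℕ → Graph
K k = record
  { n = k
  ; Adj = λ i j → if does (i ≟ j) then false else true
  ; adj-sym = symK
  ; adj-irrefl = irrK }
  where
  open import Relation.Binary.PropositionalEquality using (refl; sym)
  open import Relation.Nullary using (yes; no)
  symK : ∀ (i j : Fin k) → (if does (i ≟ j) then false else true) ≡ (if does (j ≟ i) then false else true)
  symK i j with i ≟ j | j ≟ i
  ... | yes _ | yes _ = refl
  ... | no _  | no _  = refl
  ... | yes p | no q  = Data.Empty.⊥-elim (q (sym p))
    where import Data.Empty
  ... | no p  | yes q = Data.Empty.⊥-elim (p (sym q))
    where import Data.Empty
  irrK : ∀ (i : Fin k) → (if does (i ≟ i) then false else true) ≡ false
  irrK i with i ≟ i
  ... | yes _ = refl
  ... | no p = Data.Empty.⊥-elim (p refl)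
    where import Data.Empty

Kb : ℕ → ℕ → Graph
Kb a b = record
  { n = a + b
  ; Adj = λ i j → side i xor side j
  ; adj-sym = λ i j → xor-comm (side i) (side j)
  ; adj-irrefl = λ i → xor-same (side i) }
  where
  open import Relation.Binary.PropositionalEquality using (refl)
  side : Fin (a + b) → Bool
  side i = does (toℕ i <? a)
  xor-comm : ∀ x y → (x xor y) ≡ (y xor x)
  xor-comm true true = refl
  xor-comm true false = refl
  xor-comm false true = refl
  xor-comm false false = refl
  xor-same : ∀ x → (x xor x) ≡ false
  xor-same true = refl
  xor-same false = refl

-- For all d and R there is a bipartite graph of minimum degree ≥ d all of whose cycles are
-- longer than R. Let the letters a < d act on the words of length ≤ R by the involutions σ a of
-- a truncated free product of copies of ℤ/2, and join (b, π) to (not b, σ a ∘ π), where π ranges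
-- over the bijections from positions to words. The bit is a proper 2-colouring, the d neighbours
-- of a vertex are distinct, and along a non-backtracking walk of length L ≤ R the word at the
-- position where the first π is empty grows to length L, so no such walk is closed.
-- With R larger than every member of 𝒞 this graph lies in Forb 𝒞, has χ = 2 and arbitrarily
-- large δ, so no f tending to infinity satisfies f(δ) ≤ χ.
module Submission where

open import Defs

open import Data.Bool using (Bool; true; false; not; _∧_; if_then_else_)
open import Data.Bool.Properties as Bool using (T-≡; not-involutive; not-¬)
open import Data.Empty using (⊥-elim)
open import Data.Fin as Fin using (Fin; zero; suc; toℕ; inject₁; fromℕ; fromℕ<; _↑ˡ_; _↑ʳ_; splitAt)
import Data.Fin.Properties as Fin
open import Data.List
  using (List; []; _∷_; length; head; map; allFin; concatMap; lookup; filter; filterᵇ; deduplicate; cartesianProduct)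
import Data.List.Properties as List
open import Data.List.Membership.Propositional using (_∈_)
open import Data.List.Membership.Propositional.Properties
  using ( ∈-allFin; ∈-lookup; ∈-map⁺; ∈-map⁻; ∈-concatMap⁺; ∈-concatMap⁻; ∈-filter⁺; ∈-filter⁻
        ; ∈-deduplicate⁺; ∈-deduplicate⁻; ∈-cartesianProduct⁺)
open import Data.List.Relation.Unary.All as All using (All)
open import Data.List.Relation.Unary.All.Properties as All using (tabulate⁺)
open import Data.List.Relation.Unary.AllPairs using (_∷_)
open import Data.List.Relation.Unary.Any as Any using (here; there)
open import Data.List.Relation.Unary.Any.Properties using (lookup-index)
open import Data.List.Relation.Unary.Unique.Propositional using (Unique)
import Data.List.Relation.Unary.Unique.DecPropositional.Properties as Unique
open import Data.Maybe using (just)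
open import Data.Maybe.Properties as Maybe using (just-injective)
open import Data.Nat using (ℕ; zero; suc; _+_; _≤_; _<_; _<?_; z≤n; s≤s)
open import Data.Nat.DivMod using (_mod_; m<n⇒m%n≡m; n%n≡0)
open import Data.Nat.ListAction using (sum)
import Data.Nat.Properties as ℕ
open import Data.Product using (Σ; Σ-syntax; ∃; _×_; _,_; proj₁; proj₂)
import Data.Product.Properties as Product
open import Data.Sum using (_⊎_; inj₁; inj₂)
open import Data.Unit using (⊤)
open import Data.Vec as Vec using (Vec; []; _∷_)
import Data.Vec.Properties as Vec
open import Function using (_∘_)
open import Function.Bundles using (Equivalence)
open import Function.Definitions using (Injective)
open import Level using (0ℓ)
open import Relation.Binary as Binary using (Rel; Symmetric; Irreflexive; DecidableEquality)
open import Relation.Binary.PropositionalEquality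
open import Relation.Nullary using (¬_; Dec; yes; no; does; ¬?; _×-dec_)
open import Relation.Nullary.Decidable using (dec-true; dec-false)
open import Relation.Unary as Unary using (Pred)

indicator-sum≡length-filterᵇ : ∀ {A : Set} (p : A → Bool) (xs : List A) →
  sum (map (λ x → if p x then 1 else 0) xs) ≡ length (filterᵇ p xs)
indicator-sum≡length-filterᵇ p [] = refl
indicator-sum≡length-filterᵇ p (x ∷ xs) with p x
... | true  = cong suc (indicator-sum≡length-filterᵇ p xs)
... | false = indicator-sum≡length-filterᵇ p xs

injection⇒≤length : ∀ {A : Set} {d} {xs : List A} (h : Fin d → A) →
  Injective _≡_ _≡_ h → (∀ k → h k ∈ xs) → d ≤ length xs
injection⇒≤length {xs = xs} h h-inj h∈ = Fin.injective⇒≤ λ {k} {l} e →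
  h-inj (trans (lookup-index (h∈ k)) (trans (cong (lookup xs) e) (sym (lookup-index (h∈ l)))))

Unique⇒lookup-injective : ∀ {A : Set} {xs : List A} → Unique xs → Injective _≡_ _≡_ (lookup xs)
Unique⇒lookup-injective (_ ∷ _) {zero} {zero} _ = refl
Unique⇒lookup-injective (x∉ ∷ _) {zero} {suc j} e = ⊥-elim (All.lookup x∉ (∈-lookup j) e)
Unique⇒lookup-injective (x∉ ∷ _) {suc i} {zero} e = ⊥-elim (All.lookup x∉ (∈-lookup i) (sym e))
Unique⇒lookup-injective (_ ∷ u) {suc i} {suc j} e = cong suc (Unique⇒lookup-injective u e)

∈⇒≤sum : ∀ {k ks} → k ∈ ks → k ≤ sum ks
∈⇒≤sum (here refl) = ℕ.m≤m+n _ _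
∈⇒≤sum {ks = k′ ∷ _} (there k∈) = ℕ.≤-trans (∈⇒≤sum k∈) (ℕ.m≤n+m _ k′)

vectors : ∀ {A : Set} → List A → (k : ℕ) → List (Vec A k)
vectors xs zero    = [] ∷ []
vectors xs (suc k) = concatMap (λ x → map (x ∷_) (vectors xs k)) xs

∈-vectors⁺ : ∀ {A : Set} {xs : List A} {k} {v : Vec A k} →
             (∀ i → Vec.lookup v i ∈ xs) → v ∈ vectors xs k
∈-vectors⁺ {v = []}    _   = here refl
∈-vectors⁺ {v = x ∷ v} ∈xs =
  ∈-concatMap⁺ _ (Any.map (λ { refl → ∈-map⁺ (x ∷_) (∈-vectors⁺ (∈xs ∘ suc)) }) (∈xs zero))

≤minOver : ∀ {d} k (g : Fin k → ℕ) → 0 < k → (∀ i → d ≤ g i) → d ≤ minOver k g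
≤minOver {d} (suc k) g _ d≤g =
  List.foldr-preservesᵇ {P = d ≤_} ℕ.⊓-glb (d≤g zero) (All.map⁺ (tabulate⁺ {P = λ i → d ≤ g i} d≤g))

≤degree : ∀ (G : Graph) {d} v (h : Fin d → Fin (n G)) → Injective _≡_ _≡_ h →
          (∀ k → Adj G v (h k) ≡ true) → d ≤ degree G v
≤degree G v h h-inj adj =
  subst (_ ≤_) (sym (indicator-sum≡length-filterᵇ (Adj G v) (allFin (n G))))
    (injection⇒≤length h h-inj λ k →
      ∈-filter⁺ _ (∈-allFin (h k)) (Equivalence.from T-≡ (adj k)))

χ≡2 : ∀ (G : Graph) {i j} → Colorable G 2 → Adj G i j ≡ true → IsChromaticNumber G 2
χ≡2 G {i} {j} 2-col i~j = 2-col , no-smaller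
  where
  no-smaller : ∀ k → k < 2 → ¬ Colorable G k
  no-smaller zero _ (col , _) = Fin.¬Fin0 (col i)
  no-smaller (suc zero) _ (col , proper) with col i | col j | proper i j i~j
  ... | zero | zero | col-i≢col-j = col-i≢col-j refl
  no-smaller (suc (suc _)) (s≤s (s≤s ())) _

LongCycles : ℕ → Graph → Set
LongCycles R G = (cycle : HasCycle G) → R < 3 + proj₁ cycle

cycle-length≤ : ∀ {H} (cycle : HasCycle H) → 3 + proj₁ cycle ≤ n H
cycle-length≤ (_ , _ , c-inj , _) = Fin.injective⇒≤ c-inj

map-cycle : ∀ {H G} → H ⊑ind G → HasCycle H → HasCycle G
map-cycle (f , f-inj , f-adj) (m , c , c-inj , c-adj , c-close) =
  m , f ∘ c , c-inj ∘ f-inj ,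
  (λ i → trans (sym (f-adj (c (inject₁ i)) (c (suc i)))) (c-adj i)) ,
  trans (sym (f-adj (c (fromℕ (2 + m))) (c zero))) c-close

LongCycles⇒Forb : ∀ {𝒞 G} → (∀ H → H ∈ 𝒞 → HasCycle H) →
                  LongCycles (sum (map n 𝒞)) G → Forb 𝒞 G
LongCycles⇒Forb {G = G} cycles long H H∈𝒞 H⊑G = ℕ.<-irrefl refl
  (ℕ.<-≤-trans (long (map-cycle {H} {G} H⊑G cycle))
    (ℕ.≤-trans (cycle-length≤ {H} cycle) (∈⇒≤sum (∈-map⁺ n H∈𝒞))))
  where cycle = cycles H H∈𝒞

NonBacktrackingClosedWalk : Graph → ℕ → Set
NonBacktrackingClosedWalk G L = Σ (ℕ → Fin (n G)) λ w →
  (∀ k → k < L → Adj G (w k) (w (suc k)) ≡ true) ×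
  (∀ k → 2 + k ≤ L → w k ≢ w (2 + k)) ×
  w L ≡ w 0

cycle⇒walk : ∀ {G} (cycle : HasCycle G) → NonBacktrackingClosedWalk G (3 + proj₁ cycle)
cycle⇒walk {G} (m , c , c-inj , c-adj , c-close) =
  c ∘ position , adjacent , non-backtracking , cong c position-L
  where
  L = 3 + m

  position : ℕ → Fin L
  position k = k mod L

  toℕ-position : ∀ {k} → k < L → toℕ (position k) ≡ k
  toℕ-position k<L = trans (Fin.toℕ-fromℕ< _) (m<n⇒m%n≡m k<L)

  position-≡ : ∀ {k} (i : Fin L) → k < L → toℕ i ≡ k → position k ≡ i
  position-≡ i k<L i≡k = Fin.toℕ-injective (trans (toℕ-position k<L) (sym i≡k))

  position-L : position L ≡ zero
  position-L = Fin.toℕ-injective (trans (Fin.toℕ-fromℕ< _) (n%n≡0 L))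

  adjacent : ∀ k → k < L → Adj G (c (position k)) (c (position (suc k))) ≡ true
  adjacent k k<L with ℕ.m≤n⇒m<n∨m≡n k<L
  ... | inj₁ 1+k<L = subst₂ (λ i j → Adj G (c i) (c j) ≡ true)
      (sym (position-≡ _ k<L (trans (Fin.toℕ-inject₁ i) (Fin.toℕ-fromℕ< _))))
      (sym (position-≡ _ 1+k<L (cong suc (Fin.toℕ-fromℕ< _))))
      (c-adj i)
    where i = fromℕ< (ℕ.≤-pred 1+k<L)
  ... | inj₂ refl = subst₂ (λ i j → Adj G (c i) (c j) ≡ true)
      (sym (position-≡ _ k<L (Fin.toℕ-fromℕ _))) (sym position-L) c-close

  non-backtracking : ∀ k → 2 + k ≤ L → c (position k) ≢ c (position (2 + k))
  non-backtracking k 2+k≤L e with trans (sym (toℕ-position (ℕ.<-trans (ℕ.n<1+n k) 2+k≤L)))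
                                        (cong toℕ (c-inj e))
  ... | k≡ with ℕ.m≤n⇒m<n∨m≡n 2+k≤L
  ...   | inj₁ 2+k<L = ℕ.m≢1+m+n k (trans k≡ (trans (toℕ-position 2+k<L) (cong suc (ℕ.+-comm 1 k))))
  ...   | inj₂ refl = ℕ.1+n≢0 (trans k≡ (cong toℕ position-L))

module FiniteGraph {A : Set} (_≟_ : DecidableEquality A)
  {P : Pred A 0ℓ} (P? : Unary.Decidable P)
  (candidates : List A) (complete : ∀ {x} → P x → x ∈ candidates)
  {_~_ : Rel A 0ℓ} (_~?_ : Binary.Decidable _~_)
  (~-sym : Symmetric _~_) (~-irrefl : Irreflexive _≡_ _~_) where

  elements : List A
  elements = deduplicate _≟_ (filter P? candidates)

  vertex : Fin (length elements) → A
  vertex = lookup elements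

  graph : Graph
  graph = record
    { n          = length elements
    ; Adj        = λ i j → does (vertex i ~? vertex j)
    ; adj-sym    = λ i j → does-sym (vertex i) (vertex j)
    ; adj-irrefl = λ i → dec-false (vertex i ~? vertex i) (~-irrefl refl)
    }
    where
    does-sym : ∀ x y → does (x ~? y) ≡ does (y ~? x)
    does-sym x y with x ~? y
    ... | yes x~y = sym (dec-true (y ~? x) (~-sym x~y))
    ... | no x≁y  = sym (dec-false (y ~? x) (x≁y ∘ ~-sym))

  vertex-injective : Injective _≡_ _≡_ vertex
  vertex-injective = Unique⇒lookup-injective (Unique.deduplicate-! _≟_ (filter P? candidates))

  vertex-satisfies : ∀ i → P (vertex i)
  vertex-satisfies i =
    proj₂ (∈-filter⁻ P? {xs = candidates} (∈-deduplicate⁻ _≟_ _ (∈-lookup i)))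

  index : ∀ x → P x → Fin (n graph)
  index x px = Any.index (∈-deduplicate⁺ _≟_ (∈-filter⁺ P? (complete px) px))

  vertex-index : ∀ x (px : P x) → vertex (index x px) ≡ x
  vertex-index x px = sym (lookup-index (∈-deduplicate⁺ _≟_ (∈-filter⁺ P? (complete px) px)))

  adj⇒~ : ∀ {i j} → Adj graph i j ≡ true → vertex i ~ vertex j
  adj⇒~ {i} {j} e with vertex i ~? vertex j | e
  ... | yes i~j | _ = i~j

  ~⇒adj : ∀ i x (px : P x) → vertex i ~ x → Adj graph i (index x px) ≡ true
  ~⇒adj i x px i~x =
    dec-true (vertex i ~? vertex (index x px)) (subst (vertex i ~_) (sym (vertex-index x px)) i~x)

  ≤degree-of-neighbours : ∀ {d} i (nbr : Fin d → A) → Injective _≡_ _≡_ nbr →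
    (nbr-satisfies : ∀ a → P (nbr a)) → (∀ a → vertex i ~ nbr a) → d ≤ degree graph i
  ≤degree-of-neighbours i nbr nbr-inj nbr-satisfies i~nbr =
    ≤degree graph i (λ a → index (nbr a) (nbr-satisfies a))
      (λ {a} {b} e → nbr-inj (trans (sym (vertex-index _ (nbr-satisfies a)))
                               (trans (cong vertex e) (vertex-index _ (nbr-satisfies b)))))
      (λ a → ~⇒adj i (nbr a) (nbr-satisfies a) (i~nbr a))

-- On reduced words σ a is multiplication by the generator a of the free product of d copies of
-- ℤ/2, except that it fixes the words of length R that it would lengthen.
module TruncatedInvolutions (d R : ℕ) where

  Word : Set
  Word = List (Fin d)

  Prependable : Fin d → Word → Set
  Prependable a w = head w ≢ just a × length w < R

  prependable? : ∀ a w → Dec (Prependable a w)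
  prependable? a w = ¬? (Maybe.≡-dec Fin._≟_ (head w) (just a)) ×-dec (length w <? R)

  ¬prependable-twice : ∀ {a w} → ¬ Prependable a (a ∷ w)
  ¬prependable-twice (a∉ , _) = a∉ refl

  -- Opaque so that unification never unfolds σ; the lemmas in the block are its interface.
  opaque
    strip : Fin d → Word → Word
    strip a []      = []
    strip a (b ∷ w) = if does (b Fin.≟ a) ∧ does (prependable? a w) then w else b ∷ w

    σ : Fin d → Word → Word
    σ a w = if does (prependable? a w) then a ∷ w else strip a w

    σ-prepend : ∀ {a w} → Prependable a w → σ a w ≡ a ∷ w
    σ-prepend {a} {w} p rewrite dec-true (prependable? a w) p = refl

    σ-strip : ∀ {a w} → ¬ Prependable a w → σ a w ≡ strip a w
    σ-strip {a} {w} ¬p rewrite dec-false (prependable? a w) ¬p = refl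

    strip-[] : ∀ {a} → strip a [] ≡ []
    strip-[] = refl

    strip-prepended : ∀ {a w} → Prependable a w → strip a (a ∷ w) ≡ w
    strip-prepended {a} {w} p rewrite dec-true (a Fin.≟ a) refl | dec-true (prependable? a w) p = refl

    strip-unprependable : ∀ {a w} → ¬ Prependable a w → strip a (a ∷ w) ≡ a ∷ w
    strip-unprependable {a} {w} ¬p rewrite dec-true (a Fin.≟ a) refl | dec-false (prependable? a w) ¬p = refl

    strip-other : ∀ {a b w} → b ≢ a → strip a (b ∷ w) ≡ b ∷ w
    strip-other {a} {b} b≢a rewrite dec-false (b Fin.≟ a) b≢a = refl

    strip-length : ∀ a w → length (strip a w) ≤ length w
    strip-length a []      = z≤n
    strip-length a (b ∷ w) with does (b Fin.≟ a) ∧ does (prependable? a w)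
    ... | true  = ℕ.n≤1+n _
    ... | false = ℕ.≤-refl

  σ-strip-inverse : ∀ {a w} → ¬ Prependable a w → σ a (strip a w) ≡ w
  σ-strip-inverse {a} {[]}    ¬p = trans (cong (σ a) strip-[]) (trans (σ-strip ¬p) strip-[])
  σ-strip-inverse {a} {b ∷ w} ¬p = by-cases (b Fin.≟ a) (prependable? a w)
    where
    by-cases : Dec (b ≡ a) → Dec (Prependable a w) → σ a (strip a (b ∷ w)) ≡ b ∷ w
    by-cases (no b≢a)  _       = trans (cong (σ a) (strip-other b≢a))
                                        (trans (σ-strip ¬p) (strip-other b≢a))
    by-cases (yes refl) (yes q) = trans (cong (σ a) (strip-prepended q)) (σ-prepend q)
    by-cases (yes refl) (no ¬q) = trans (cong (σ a) (strip-unprependable ¬q))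
                                        (trans (σ-strip ¬p) (strip-unprependable ¬q))

  σ-involutive : ∀ a w → σ a (σ a w) ≡ w
  σ-involutive a w with prependable? a w
  ... | yes p = trans (cong (σ a) (σ-prepend p))
                  (trans (σ-strip (¬prependable-twice {a} {w})) (strip-prepended p))
  ... | no ¬p = trans (cong (σ a) (σ-strip ¬p)) (σ-strip-inverse ¬p)

  σ-length : ∀ a w → length w ≤ R → length (σ a w) ≤ R
  σ-length a w |w|≤R with prependable? a w
  ... | yes p@(_ , |w|<R) = subst (λ v → length v ≤ R) (sym (σ-prepend p)) |w|<R
  ... | no ¬p = subst (λ v → length v ≤ R) (sym (σ-strip ¬p)) (ℕ.≤-trans (strip-length a w) |w|≤R)

  wordsUpTo : ℕ → List Word
  wordsUpTo zero    = [] ∷ []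
  wordsUpTo (suc k) = [] ∷ concatMap (λ a → map (a ∷_) (wordsUpTo k)) (allFin d)

  ∈-wordsUpTo⁺ : ∀ {k w} → length w ≤ k → w ∈ wordsUpTo k
  ∈-wordsUpTo⁺ {zero}  {[]}    _         = here refl
  ∈-wordsUpTo⁺ {suc k} {[]}    _         = here refl
  ∈-wordsUpTo⁺ {suc k} {a ∷ w} (s≤s |w|≤k) =
    there (∈-concatMap⁺ _ (Any.map (λ { refl → ∈-map⁺ (a ∷_) (∈-wordsUpTo⁺ |w|≤k) }) (∈-allFin a)))

  ∈-wordsUpTo⁻ : ∀ {k w} → w ∈ wordsUpTo k → length w ≤ k
  ∈-wordsUpTo⁻ {_}     {[]}    _                 = z≤n
  ∈-wordsUpTo⁻ {zero}  {_ ∷ _} (here ())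
  ∈-wordsUpTo⁻ {zero}  {_ ∷ _} (there ())
  ∈-wordsUpTo⁻ {suc k} {_ ∷ _} (there w∈) with Any.satisfied (∈-concatMap⁻ _ {xs = allFin d} w∈)
  ... | _ , w∈′ with ∈-map⁻ _ w∈′
  ...   | _ , w′∈ , refl = s≤s (∈-wordsUpTo⁻ w′∈)

module Construction (d R : ℕ) where
  open TruncatedInvolutions d R

  ball : List Word
  ball = wordsUpTo R

  Arrangement : Set
  Arrangement = Vec Word (length ball)

  Vertex : Set
  Vertex = Bool × Arrangement

  Covers : Arrangement → Set
  Covers v = All (λ w → ∃ λ i → Vec.lookup v i ≡ w) ball

  Bounded : Arrangement → Set
  Bounded v = ∀ i → length (Vec.lookup v i) ≤ R

  -- Good arrangements are the bijections from positions to the ball; the bit makes the graph bipartite.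
  Good : Vertex → Set
  Good (_ , v) = Covers v × Bounded v

  _≟W_ : DecidableEquality Word
  _≟W_ = List.≡-dec Fin._≟_

  _≟V_ : DecidableEquality Vertex
  _≟V_ = Product.≡-dec Bool._≟_ (Vec.≡-dec _≟W_)

  good? : Unary.Decidable Good
  good? (_ , v) = All.all? (λ w → Fin.any? λ i → Vec.lookup v i ≟W w) ball
           ×-dec Fin.all? (λ i → length (Vec.lookup v i) ℕ.≤? R)

  candidates : List Vertex
  candidates = cartesianProduct (true ∷ false ∷ []) (vectors ball (length ball))

  complete : ∀ {x} → Good x → x ∈ candidates
  complete {b , v} (_ , bounded) =
    ∈-cartesianProduct⁺ (bool∈ b) (∈-vectors⁺ (λ i → ∈-wordsUpTo⁺ (bounded i)))
    where
    bool∈ : ∀ b → b ∈ true ∷ false ∷ []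
    bool∈ true  = here refl
    bool∈ false = there (here refl)

  act : Fin d → Arrangement → Arrangement
  act a = Vec.map (σ a)

  act-involutive : ∀ a v → act a (act a v) ≡ v
  act-involutive a v = begin
    act a (act a v)      ≡⟨ Vec.map-∘ (σ a) (σ a) v ⟨
    Vec.map (σ a ∘ σ a) v ≡⟨ Vec.map-cong (σ-involutive a) v ⟩
    Vec.map (λ w → w) v  ≡⟨ Vec.map-id v ⟩
    v                    ∎
    where open ≡-Reasoning

  _~_ : Rel Vertex 0ℓ
  (b , v) ~ (b′ , v′) = b′ ≡ not b × ∃ λ a → act a v ≡ v′

  _~?_ : Binary.Decidable _~_
  (b , v) ~? (b′ , v′) = (b′ Bool.≟ not b) ×-dec Fin.any? (λ a → Vec.≡-dec _≟W_ (act a v) v′)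

  ~-sym : Symmetric _~_
  ~-sym {b , v} (refl , a , refl) = sym (not-involutive b) , a , act-involutive a v

  ~-irrefl : Irreflexive _≡_ _~_
  ~-irrefl refl (b≡¬b , _) = not-¬ refl b≡¬b

  open FiniteGraph _≟V_ good? candidates complete _~?_ ~-sym ~-irrefl public

  neighbour : Vertex → Fin d → Vertex
  neighbour (b , v) a = not b , act a v

  act-preserves-Good : ∀ x a → Good x → Good (neighbour x a)
  act-preserves-Good (b , v) a (covers , bounded) = All.tabulate covered , bounded′
    where
    covered : ∀ {w} → w ∈ ball → ∃ λ i → Vec.lookup (act a v) i ≡ w
    covered {w} w∈ball with All.lookup covers (∈-wordsUpTo⁺ (σ-length a w (∈-wordsUpTo⁻ w∈ball)))
    ... | i , v[i]≡σw = i , (begin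
      Vec.lookup (act a v) i ≡⟨ Vec.lookup-map i (σ a) v ⟩
      σ a (Vec.lookup v i)   ≡⟨ cong (σ a) v[i]≡σw ⟩
      σ a (σ a w)            ≡⟨ σ-involutive a w ⟩
      w                      ∎)
      where open ≡-Reasoning
    bounded′ : Bounded (act a v)
    bounded′ i = subst (λ w → length w ≤ R) (sym (Vec.lookup-map i (σ a) v)) (σ-length a (Vec.lookup v i) (bounded i))

  position-of-[] : ∀ v → Covers v → ∃ λ p → Vec.lookup v p ≡ []
  position-of-[] v covers = All.lookup covers (∈-wordsUpTo⁺ z≤n)

  neighbour-injective : 0 < R → ∀ x → Good x → Injective _≡_ _≡_ (neighbour x)
  neighbour-injective 0<R (b , v) (covers , _) {a} {a′} e = List.∷-injectiveˡ (begin
    a ∷ []                   ≡⟨ σ-prepend ((λ ()) , 0<R) ⟨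
    σ a []                   ≡⟨ cong (σ a) v[p]≡[] ⟨
    σ a (Vec.lookup v p)     ≡⟨ Vec.lookup-map p (σ a) v ⟨
    Vec.lookup (act a v) p   ≡⟨ cong (λ x → Vec.lookup (proj₂ x) p) e ⟩
    Vec.lookup (act a′ v) p  ≡⟨ Vec.lookup-map p (σ a′) v ⟩
    σ a′ (Vec.lookup v p)    ≡⟨ cong (σ a′) v[p]≡[] ⟩
    σ a′ []                  ≡⟨ σ-prepend ((λ ()) , 0<R) ⟩
    a′ ∷ []                  ∎)
    where
    open ≡-Reasoning
    p = proj₁ (position-of-[] v covers)
    v[p]≡[] = proj₂ (position-of-[] v covers)

  d≤degree : 0 < R → ∀ i → d ≤ degree graph i
  d≤degree 0<R i = ≤degree-of-neighbours i (neighbour (vertex i))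
    (neighbour-injective 0<R (vertex i) (vertex-satisfies i))
    (λ a → act-preserves-Good (vertex i) a (vertex-satisfies i))
    (λ a → refl , a , refl)

  initial : Vertex
  initial = true , Vec.tabulate (lookup ball)

  initial-Good : Good initial
  initial-Good = All.tabulate covered , bounded
    where
    covered : ∀ {w} → w ∈ ball → ∃ λ i → Vec.lookup (proj₂ initial) i ≡ w
    covered w∈ = Any.index w∈ , trans (Vec.lookup∘tabulate (lookup ball) _) (sym (lookup-index w∈))
    bounded : Bounded (proj₂ initial)
    bounded i = subst (λ w → length w ≤ R) (sym (Vec.lookup∘tabulate (lookup ball) i))
                      (∈-wordsUpTo⁻ (∈-lookup i))

  d≤δ : 0 < R → d ≤ δ graph
  d≤δ 0<R = ≤minOver (n graph) (degree graph) (ℕ.≤-<-trans z≤n (Fin.toℕ<n (index initial initial-Good))) (d≤degree 0<R)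

  colour : Bool → Fin 2
  colour b = if b then suc zero else zero

  colour-not : ∀ b → colour b ≢ colour (not b)
  colour-not true  ()
  colour-not false ()

  2-colourable : Colorable graph 2
  2-colourable = colour ∘ proj₁ ∘ vertex , λ i j i~j →
    subst (λ b → colour (proj₁ (vertex i)) ≢ colour b) (sym (proj₁ (adj⇒~ i~j))) (colour-not _)

  χ[graph]≡2 : 0 < d → IsChromaticNumber graph 2
  χ[graph]≡2 (s≤s _) = χ≡2 graph 2-colourable
    (~⇒adj (index initial initial-Good) _ (act-preserves-Good initial zero initial-Good)
      (subst (_~ neighbour initial zero) (sym (vertex-index initial initial-Good)) (refl , zero , refl)))

  backtrack : ∀ {x y z a} → x ~ y → y ~ z →
              act a (proj₂ x) ≡ proj₂ y → act a (proj₂ y) ≡ proj₂ z → x ≡ z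
  backtrack {b , v} {a = a} (refl , _) (refl , _) refl refl =
    cong₂ _,_ (sym (not-involutive b)) (sym (act-involutive a v))

  -- Along a non-backtracking walk the word at the position of [] in the first arrangement
  -- gets one letter prepended per step, so the walk cannot close up.
  module Tracking {L} (X : ℕ → Vertex) (step : ∀ k → k < L → X k ~ X (suc k))
    (no-backtrack : ∀ k → 2 + k ≤ L → X k ≢ X (2 + k)) (L≤R : L ≤ R)
    (p : Fin (length ball)) (start : Vec.lookup (proj₂ (X 0)) p ≡ []) where

    word : ℕ → Word
    word k = Vec.lookup (proj₂ (X k)) p

    LastLetter : ℕ → Set
    LastLetter zero    = ⊤
    LastLetter (suc k) = ∃ λ a → act a (proj₂ (X k)) ≡ proj₂ (X (suc k)) × word (suc k) ≡ a ∷ word k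

    no-cancellation : ∀ k {a} → suc k ≤ L → LastLetter k → act a (proj₂ (X k)) ≡ proj₂ (X (suc k)) →
            head (word k) ≢ just a
    no-cancellation zero _ _ _ e with trans (sym (cong head start)) e
    ... | ()
    no-cancellation (suc k) 2+k≤L (a′ , act′ , word≡) act″ e =
      no-backtrack k 2+k≤L (backtrack (step k (ℕ.<-trans (ℕ.n<1+n k) 2+k≤L)) (step (suc k) 2+k≤L)
                                      (subst (λ b → act b _ ≡ _) a′≡a act′) act″)
      where a′≡a = just-injective (trans (sym (cong head word≡)) e)

    grows : ∀ k → k ≤ L → length (word k) ≡ k × LastLetter k
    grows zero    _   = cong length start , _
    grows (suc k) k<L with grows k (ℕ.<⇒≤ k<L) | step k k<L
    ... | |word|≡k , last | _ , a , act≡ = trans (cong length word≡) (cong suc |word|≡k) , a , act≡ , word≡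
      where
      open ≡-Reasoning
      word≡ : word (suc k) ≡ a ∷ word k
      word≡ = begin
        word (suc k)                        ≡⟨ cong (λ v → Vec.lookup v p) act≡ ⟨
        Vec.lookup (act a (proj₂ (X k))) p  ≡⟨ Vec.lookup-map p (σ a) (proj₂ (X k)) ⟩
        σ a (word k)                        ≡⟨ σ-prepend (no-cancellation k k<L last act≡ ,
                                                 subst (_< R) (sym |word|≡k) (ℕ.<-≤-trans k<L L≤R)) ⟩
        a ∷ word k                          ∎

  no-short-walk : ∀ {L} → 1 ≤ L → L ≤ R → ¬ NonBacktrackingClosedWalk graph L
  no-short-walk {L} (s≤s _) L≤R (w , adjacent , non-backtracking , closed) =
    ℕ.1+n≢0 (begin
      L                  ≡⟨ proj₁ (grows L ℕ.≤-refl) ⟨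
      length (word L)    ≡⟨ cong (λ i → length (Vec.lookup (proj₂ (vertex i)) p)) closed ⟩
      length (word 0)    ≡⟨ cong length start ⟩
      0                  ∎)
    where
    open ≡-Reasoning
    X = vertex ∘ w
    p = proj₁ (position-of-[] (proj₂ (X 0)) (proj₁ (vertex-satisfies (w 0))))
    start = proj₂ (position-of-[] (proj₂ (X 0)) (proj₁ (vertex-satisfies (w 0))))
    open Tracking X (λ k k<L → adj⇒~ (adjacent k k<L)) (λ k 2+k≤L → non-backtracking k 2+k≤L ∘ vertex-injective)
                  L≤R p start

  long-cycles : LongCycles R graph
  long-cycles cycle = ℕ.≰⇒> λ 3+m≤R → no-short-walk (s≤s z≤n) 3+m≤R (cycle⇒walk {graph} cycle)

-- Opaque: the graph has astronomically many vertices and must never be normalised.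
opaque
  bipartite-high-girth : ∀ d R → Σ[ G ∈ Graph ] d ≤ δ G × IsChromaticNumber G 2 × LongCycles R G
  bipartite-high-girth d R =
    graph , ℕ.≤-trans (ℕ.n≤1+n d) (d≤δ (s≤s z≤n)) , χ[graph]≡2 (s≤s z≤n) ,
    λ cycle → ℕ.<-trans (ℕ.n<1+n R) (long-cycles cycle)
    where open Construction (suc d) (suc R)

not-δχ-bounded : (𝒞 : List Graph) → (∀ H → H ∈ 𝒞 → HasCycle H) → ¬ DeltaChiBounded (Forb 𝒞)
not-δχ-bounded 𝒞 cycles (f , f→∞ , f≤χ) with f→∞ 3
... | N , 3≤f with bipartite-high-girth N (sum (map n 𝒞))
...   | G , N≤δ , χ[G]≡2 , long =
  ℕ.<-irrefl refl (ℕ.≤-trans (3≤f (δ G) N≤δ) (f≤χ G (LongCycles⇒Forb {𝒞} {G} cycles long) 2 χ[G]≡2))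

K3-cycle : HasCycle (K 3)
K3-cycle = 0 , (λ i → i) , (λ e → e) , (λ { zero → refl ; (suc zero) → refl }) , refl

Kb-adj-ˡʳ : ∀ a b (i : Fin a) (j : Fin b) → Adj (Kb a b) (i ↑ˡ b) (a ↑ʳ j) ≡ true
Kb-adj-ˡʳ a b i j
  rewrite dec-true (toℕ (i ↑ˡ b) <? a) (subst (_< a) (sym (Fin.toℕ-↑ˡ i b)) (Fin.toℕ<n i))
        | dec-false (toℕ (a ↑ʳ j) <? a) (ℕ.≤⇒≯ (subst (a ≤_) (sym (Fin.toℕ-↑ʳ a j)) (ℕ.m≤m+n a _)))
  = refl

Kb-adj-ʳˡ : ∀ a b (i : Fin a) (j : Fin b) → Adj (Kb a b) (a ↑ʳ j) (i ↑ˡ b) ≡ true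
Kb-adj-ʳˡ a b i j = trans (adj-sym (Kb a b) (a ↑ʳ j) (i ↑ˡ b)) (Kb-adj-ˡʳ a b i j)

Kb-cycle : ∀ a b → HasCycle (Kb (2 + a) (2 + b))
Kb-cycle a b = 1 , c , c-injective , adjacent , Kb-adj-ʳˡ (2 + a) (2 + b) zero (suc zero)
  where
  left : Fin (2 + a) → Fin ((2 + a) + (2 + b))
  left i = i ↑ˡ (2 + b)

  right : Fin (2 + b) → Fin ((2 + a) + (2 + b))
  right j = (2 + a) ↑ʳ j

  c : Fin 4 → Fin ((2 + a) + (2 + b))
  c zero                   = left zero
  c (suc zero)             = right zero
  c (suc (suc zero))       = left (suc zero)
  c (suc (suc (suc zero))) = right (suc zero)

  c-index : Fin (2 + a) ⊎ Fin (2 + b) → Fin 4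
  c-index (inj₁ zero)    = zero
  c-index (inj₁ (suc _)) = suc (suc zero)
  c-index (inj₂ zero)    = suc zero
  c-index (inj₂ (suc _)) = suc (suc (suc zero))

  c-index-c : ∀ i → c-index (splitAt (2 + a) (c i)) ≡ i
  c-index-c zero                   = cong c-index (Fin.splitAt-↑ˡ (2 + a) zero (2 + b))
  c-index-c (suc zero)             = cong c-index (Fin.splitAt-↑ʳ (2 + a) (2 + b) zero)
  c-index-c (suc (suc zero))       = cong c-index (Fin.splitAt-↑ˡ (2 + a) (suc zero) (2 + b))
  c-index-c (suc (suc (suc zero))) = cong c-index (Fin.splitAt-↑ʳ (2 + a) (2 + b) (suc zero))

  c-injective : Injective _≡_ _≡_ c
  c-injective {i} {j} e = trans (sym (c-index-c i)) (trans (cong (c-index ∘ splitAt (2 + a)) e) (c-index-c j))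

  adjacent : ∀ (i : Fin 3) → Adj (Kb (2 + a) (2 + b)) (c (inject₁ i)) (c (suc i)) ≡ true
  adjacent zero             = Kb-adj-ˡʳ (2 + a) (2 + b) zero zero
  adjacent (suc zero)       = Kb-adj-ʳˡ (2 + a) (2 + b) (suc zero) zero
  adjacent (suc (suc zero)) = Kb-adj-ˡʳ (2 + a) (2 + b) (suc zero) (suc zero)

proposition1 : ((𝒞 : List Graph) → (∀ H → H ∈ 𝒞 → HasCycle H) → ¬ DeltaChiBounded (Forb 𝒞))
    × ((m : ℕ) → 2 ≤ m → ¬ DeltaChiBounded (Forb (K 3 ∷ Kb 2 m ∷ [])))
    × ((ℓ : ℕ) → 2 ≤ ℓ → ¬ DeltaChiBounded (Forb (Kb ℓ ℓ ∷ [])))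
proposition1 = not-δχ-bounded , triangle-free-K₂ₘ-free , Kℓℓ-free
  where
  triangle-free-K₂ₘ-free : (m : ℕ) → 2 ≤ m → ¬ DeltaChiBounded (Forb (K 3 ∷ Kb 2 m ∷ []))
  triangle-free-K₂ₘ-free (suc (suc m)) _ = not-δχ-bounded _ λ where
    _ (here refl)         → K3-cycle
    _ (there (here refl)) → Kb-cycle 0 m
  triangle-free-K₂ₘ-free (suc zero) (s≤s ())

  Kℓℓ-free : (ℓ : ℕ) → 2 ≤ ℓ → ¬ DeltaChiBounded (Forb (Kb ℓ ℓ ∷ []))
  Kℓℓ-free (suc (suc ℓ)) _ = not-δχ-bounded _ λ where
    _ (here refl) → Kb-cycle ℓ ℓ
  Kℓℓ-free (suc zero) (s≤s ())
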